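{- Let $n\ge2$ and let $\langle c^m,c^M\rangle$ be a cell of size $n$, and $i\in[n-1]$. (i) If $c^m_i<0$ then $c^M_i\le0$. (ii) If $c^m_i\ge0$ then $c^M_i>0$.
   Context: Tamari diagram of size $n$: a word $u=u_1\cdots u_n$ of integers with $0\le u_i\le n-i$ and $u_{i+j}\le u_i-j$ for all $i\in[n]$, $0\le j\le u_i$. Dual Tamari diagram of size $n$: a word $v=v_1\cdots v_n$ of integers with $0\le v_i\le i-1$ and $v_{i-j}\le v_i-j$ for all $i\in[n]$, $0\le j\le v_i$. A pair $(u,v)$ of these is a Tamari interval diagram if for all $1\le i<j\le n$ with $j-i\le u_i$ one has $v_j<j-i$. An $(n-1)$-tuple $c$ of integers is a cubic coordinate of size $n$ if the pair $(u,v)$ with $u_i=\max(c_i,0)$ ($i\in[n-1]$), $u_n=0$, $v_1=0$, $v_i=|\min(c_{i-1},0)|$ ($2\le i\le n$) is a Tamari interval diagram; $\mathcal{CC}_n$ is their set, ordered componentwise with covering relation $\lessdot$. For $c\in\mathcal{CC}_n$ and $i\in[n-1]$, $\uparrow_i(c)$ is defined when there exists $c'\in\mathcal{CC}_n$ with $c'_i>c_i$ and $c'_j=c_j$ for $j\ne i$; then $\uparrow_i(c)$ equals $c$ except that its $i$-th entry is the smallest integer $\widehat c_i>c_i$ for which the resulting tuple lies in $\mathcal{CC}_n$. A cubic coordinate $c$ is minimal-cellular if $\uparrow_i(c)$ is defined for all $i\in[n-1]$; its maximal-cellular correspondent is $\uparrow_1(\uparrow_2(\cdots(\uparrow_{n-1}(c))\cdots))$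 (always well defined). A cell $\langle c^m,c^M\rangle$ of size $n$ consists of a minimal-cellular $c^m$ of size $n$ and its maximal-cellular correspondent $c^M$. -}

module Defs where

open import Data.Nat using (ℕ; zero; suc; _∸_) renaming (_+_ to _+ℕ_; _≤_ to _≤ℕ_; _<_ to _<ℕ_)
open import Data.Integer using (ℤ; _<_; _≤_; _⊔_; _⊓_; ∣_∣; 0ℤ)
open import Data.Vec using (Vec; []; _∷_)
open import Data.Product using (Σ; _×_; ∃)
open import Relation.Binary.PropositionalEquality using (_≡_)
open import Relation.Nullary using (¬_)

-- 1-indexed lookup in a tuple of integers; positions outside [1..m] give 0
get : ∀ {m} → Vec ℤ m → ℕ → ℤ
get []       _             = 0ℤ
get (x ∷ xs) zero          = 0ℤ
get (x ∷ xs) (suc zero)    = x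
get (x ∷ xs) (suc (suc k)) = get xs (suc k)

-- 1-indexed update: replace the entry at position i (no-op if out of range)
setAt : ∀ {m} → Vec ℤ m → ℕ → ℤ → Vec ℤ m
setAt []       _             y = []
setAt (x ∷ xs) zero          y = x ∷ xs
setAt (x ∷ xs) (suc zero)    y = y ∷ xs
setAt (x ∷ xs) (suc (suc k)) y = x ∷ setAt xs (suc k) y

-- Words of size n are represented as functions ℕ → ℕ (1-indexed);
-- only the values at positions 1..n matter.

TamariDiagram : ℕ → (ℕ → ℕ) → Set
TamariDiagram n u = ∀ i → 1 ≤ℕ i → i ≤ℕ n →
  (u i ≤ℕ n ∸ i) × (∀ j → j ≤ℕ u i → u (i +ℕ j) ≤ℕ u i ∸ j)

DualTamariDiagram : ℕ → (ℕ → ℕ) → Set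
DualTamariDiagram n v = ∀ i → 1 ≤ℕ i → i ≤ℕ n →
  (v i ≤ℕ i ∸ 1) × (∀ j → j ≤ℕ v i → v (i ∸ j) ≤ℕ v i ∸ j)

TamariIntervalDiagram : ℕ → (ℕ → ℕ) → (ℕ → ℕ) → Set
TamariIntervalDiagram n u v =
  TamariDiagram n u × DualTamariDiagram n v ×
  (∀ i j → 1 ≤ℕ i → i <ℕ j → j ≤ℕ n → j ∸ i ≤ℕ u i → v j <ℕ j ∸ i)

-- the pair (u , v) attached to an (n-1)-tuple c
-- u_i = max(c_i,0) for i ∈ [n-1], u_n = 0 (get gives 0 at position n)
uOf : ∀ {m} → Vec ℤ m → ℕ → ℕ
uOf c i = ∣ get c i ⊔ 0ℤ ∣

-- v_1 = 0 (get gives 0 at position 0), v_i = |min(c_{i-1},0)| for 2 ≤ i ≤ n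
vOf : ∀ {m} → Vec ℤ m → ℕ → ℕ
vOf c i = ∣ get c (i ∸ 1) ⊓ 0ℤ ∣

CC : (n : ℕ) → Vec ℤ (n ∸ 1) → Set
CC n c = TamariIntervalDiagram n (uOf c) (vOf c)

UpDefined : (n : ℕ) → ℕ → Vec ℤ (n ∸ 1) → Set
UpDefined n i c = Σ ℤ λ x → (get c i < x) × CC n (setAt c i x)

Up : (n : ℕ) → ℕ → Vec ℤ (n ∸ 1) → Vec ℤ (n ∸ 1) → Set
Up n i c d = Σ ℤ λ x → (get c i < x) × CC n (setAt c i x) × (d ≡ setAt c i x) ×
  (∀ y → get c i < y → y < x → ¬ CC n (setAt c i y))

MinimalCellular : (n : ℕ) → Vec ℤ (n ∸ 1) → Set
MinimalCellular n c = CC n c × (∀ i → 1 ≤ℕ i → i ≤ℕ n ∸ 1 → UpDefined n i c)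

-- UpChain n k c d  :  d = ↑_1(↑_2(⋯(↑_k(c))⋯))   (all steps defined)
UpChain : (n : ℕ) → ℕ → Vec ℤ (n ∸ 1) → Vec ℤ (n ∸ 1) → Set
UpChain n zero    c d = d ≡ c
UpChain n (suc k) c d = Σ (Vec ℤ (n ∸ 1)) λ e → Up n (suc k) c e × UpChain n k e d

MaxCorrespondent : (n : ℕ) → Vec ℤ (n ∸ 1) → Vec ℤ (n ∸ 1) → Set
MaxCorrespondent n c d = UpChain n (n ∸ 1) c d

Cell : (n : ℕ) → Vec ℤ (n ∸ 1) → Vec ℤ (n ∸ 1) → Set
Cell n cm cM = MinimalCellular n cm × MaxCorrespondent n cm cM

module Submission where

-- For a cell ⟨c^m , c^M⟩ the i-th entry of c^M is the
-- value produced by ↑_i applied to a tuple whose i-th entry is still c^m_i, since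
-- ↑_1 ∘ ⋯ ∘ ↑_{n-1} applies ↑_i before ↑_{i-1}, …, ↑_1, which leave entry i alone.
-- So it suffices to understand one step ↑_i(c) = c[i ↦ x]:
--   * if c_i ≥ 0 then x > c_i ≥ 0 by definition;
--   * if c_i < 0 then c[i ↦ 0] is again a cubic coordinate (zeroing a negative
--     entry keeps u and only zeroes one entry of v, which preserves all three
--     diagram conditions), so minimality of x forces x ≤ 0.
-- The file first proves the lookup/update facts, then the zeroing lemma for Tamari
-- interval diagrams, then the one-step lemma, then the induction along the chain
-- ↑_1(↑_2(⋯(↑_k(c))⋯)); the theorem is the case k = n - 1.

open import Defs
open import Data.Nat using (ℕ; _∸_; zero; suc; z≤n; s≤s) renaming (_≤_ to _≤ℕ_; _<_ to _<ℕ_; _+_ to _+ℕ_)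
import Data.Nat.Properties as ℕP
open import Data.Integer using (ℤ; _<_; _≤_; 0ℤ; _⊔_; _⊓_; ∣_∣)
import Data.Integer.Properties as ℤP
open import Data.Vec using (Vec; []; _∷_)
open import Data.Product using (_×_; _,_)
open import Data.Sum using (_⊎_; inj₁; inj₂)
open import Relation.Binary.PropositionalEquality using (_≡_; refl; sym; trans; cong; subst; subst₂)
open import Relation.Nullary using (¬_; yes; no; contradiction)

get-setAt : ∀ {m} (c : Vec ℤ m) i x k →
  get (setAt c i x) k ≡ get c k ⊎ (get (setAt c i x) k ≡ x × k ≡ i)
get-setAt []      i             x k             = inj₁ refl
get-setAt (y ∷ c) zero          x k             = inj₁ refl
get-setAt (y ∷ c) (suc zero)    x zero          = inj₁ refl
get-setAt (y ∷ c) (suc zero)    x (suc zero)    = inj₂ (refl , refl)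
get-setAt (y ∷ c) (suc zero)    x (suc (suc k)) = inj₁ refl
get-setAt (y ∷ c) (suc (suc i)) x zero          = inj₁ refl
get-setAt (y ∷ c) (suc (suc i)) x (suc zero)    = inj₁ refl
get-setAt (y ∷ c) (suc (suc i)) x (suc (suc k)) with get-setAt c (suc i) x (suc k)
... | inj₁ same          = inj₁ same
... | inj₂ (new , k≡i)   = inj₂ (new , cong suc k≡i)

get-setAt-other : ∀ {m} (c : Vec ℤ m) i x k → ¬ (k ≡ i) → get (setAt c i x) k ≡ get c k
get-setAt-other c i x k k≢i with get-setAt c i x k
... | inj₁ same        = same
... | inj₂ (_ , k≡i)   = contradiction k≡i k≢i

get-setAt-same : ∀ {m} (c : Vec ℤ m) i x → 1 ≤ℕ i → i ≤ℕ m → get (setAt c i x) i ≡ x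
get-setAt-same (y ∷ c) (suc zero)    x _ _       = refl
get-setAt-same (y ∷ c) (suc (suc i)) x _ (s≤s i≤m) = get-setAt-same c (suc i) x (s≤s z≤n) i≤m

tamari-cong : ∀ n {u u'} → TamariDiagram n u → (∀ k → u' k ≡ u k) → TamariDiagram n u'
tamari-cong n {u} {u'} tam u'≡u i 1≤i i≤n with tam i 1≤i i≤n
... | bound , decr = subst (_≤ℕ n ∸ i) (sym (u'≡u i)) bound , decr'
  where
  decr' : ∀ j → j ≤ℕ u' i → u' (i +ℕ j) ≤ℕ u' i ∸ j
  decr' j j≤ = subst₂ _≤ℕ_ (sym (u'≡u (i +ℕ j))) (cong (_∸ j) (sym (u'≡u i)))
                      (decr j (subst (j ≤ℕ_) (u'≡u i) j≤))

Zeroing : (ℕ → ℕ) → (ℕ → ℕ) → Set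
Zeroing v v' = ∀ k → v' k ≡ v k ⊎ v' k ≡ 0

zeroing-≤ : ∀ {v v'} → Zeroing v v' → ∀ k → v' k ≤ℕ v k
zeroing-≤ z k with z k
... | inj₁ same = ℕP.≤-reflexive same
... | inj₂ zeroed = subst (_≤ℕ _) (sym zeroed) z≤n

-- Zeroing entries of a dual Tamari diagram keeps it a dual Tamari diagram:
-- a zeroed entry imposes no condition, a kept one imposes a weaker one.
dualTamari-zeroing : ∀ n {v v'} → DualTamariDiagram n v → Zeroing v v' → DualTamariDiagram n v'
dualTamari-zeroing n {v} {v'} dual z k 1≤k k≤n with dual k 1≤k k≤n | z k
... | bound , decr | inj₁ same =
  subst (_≤ℕ k ∸ 1) (sym same) bound ,
  λ j j≤ → ℕP.≤-trans (zeroing-≤ z (k ∸ j))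
             (subst (λ w → v (k ∸ j) ≤ℕ w ∸ j) (sym same) (decr j (subst (j ≤ℕ_) same j≤)))
... | _ | inj₂ zeroed =
  subst (_≤ℕ k ∸ 1) (sym zeroed) z≤n ,
  λ j j≤ → only-zero j (subst (j ≤ℕ_) zeroed j≤)
  where
  only-zero : ∀ j → j ≤ℕ 0 → v' (k ∸ j) ≤ℕ v' k ∸ j
  only-zero .0 z≤n = ℕP.≤-refl

-- Hence a Tamari interval diagram stays one when u is unchanged and v is zeroed
-- in places (the interval condition only gets weaker as v decreases).
intervalDiagram-zeroing : ∀ n {u v u' v'} → TamariIntervalDiagram n u v →
  (∀ k → u' k ≡ u k) → Zeroing v v' → TamariIntervalDiagram n u' v'
intervalDiagram-zeroing n (tam , dual , compat) u'≡u z =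
  tamari-cong n tam u'≡u , dualTamari-zeroing n dual z ,
  λ i j 1≤i i<j j≤n j∸i≤ →
    ℕP.≤-<-trans (zeroing-≤ z j) (compat i j 1≤i i<j j≤n (subst (j ∸ i ≤ℕ_) (u'≡u i) j∸i≤))

cc-zero-negative : ∀ n (c : Vec ℤ (n ∸ 1)) i → get c i < 0ℤ → CC n c → CC n (setAt c i 0ℤ)
cc-zero-negative n c i cᵢ<0 cc = intervalDiagram-zeroing n cc u-same v-zeroing
  where
  u-same : ∀ k → uOf (setAt c i 0ℤ) k ≡ uOf c k
  u-same k with get-setAt c i 0ℤ k
  ... | inj₁ same = cong (λ z → ∣ z ⊔ 0ℤ ∣) same
  ... | inj₂ (new , refl) =
    trans (cong (λ z → ∣ z ⊔ 0ℤ ∣) new) (cong ∣_∣ (sym (ℤP.i≤j⇒i⊔j≡j (ℤP.<⇒≤ cᵢ<0))))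
  v-zeroing : Zeroing (vOf c) (vOf (setAt c i 0ℤ))
  v-zeroing k with get-setAt c i 0ℤ (k ∸ 1)
  ... | inj₁ same      = inj₁ (cong (λ z → ∣ z ⊓ 0ℤ ∣) same)
  ... | inj₂ (new , _) = inj₂ (cong (λ z → ∣ z ⊓ 0ℤ ∣) new)

SignPreserved : ℤ → ℤ → Set
SignPreserved a b = (a < 0ℤ → b ≤ 0ℤ) × (0ℤ ≤ a → 0ℤ < b)

up-sign : ∀ n (c e : Vec ℤ (n ∸ 1)) i → 1 ≤ℕ i → i ≤ℕ n ∸ 1 → CC n c → Up n i c e →
  SignPreserved (get c i) (get e i)
up-sign n c e i 1≤i i≤ cc (x , cᵢ<x , _ , refl , minimal)
  rewrite get-setAt-same c i x 1≤i i≤ = nonpositive , λ 0≤cᵢ → ℤP.≤-<-trans 0≤cᵢ cᵢ<x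
  where
  nonpositive : get c i < 0ℤ → x ≤ 0ℤ
  nonpositive cᵢ<0 with x ℤP.≤? 0ℤ
  ... | yes x≤0 = x≤0
  ... | no  x≰0 = contradiction (cc-zero-negative n c i cᵢ<0 cc) (minimal 0ℤ cᵢ<0 (ℤP.≰⇒> x≰0))

upChain-above : ∀ n k (e d : Vec ℤ (n ∸ 1)) → UpChain n k e d → ∀ j → k <ℕ j → get d j ≡ get e j
upChain-above n zero    e d refl j _ = refl
upChain-above n (suc k) e d (e' , (x , _ , _ , refl , _) , chain) j k<j =
  trans (upChain-above n k e' d chain j (ℕP.<-trans (ℕP.n<1+n k) k<j))
        (get-setAt-other e (suc k) x j (λ j≡ → ℕP.<-irrefl (sym j≡) k<j))

upChain-sign : ∀ n k (c d : Vec ℤ (n ∸ 1)) → k ≤ℕ n ∸ 1 → CC n c → UpChain n k c d →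
  ∀ i → 1 ≤ℕ i → i ≤ℕ k → SignPreserved (get c i) (get d i)
upChain-sign n zero    c d _ _ _ (suc i) _ ()
upChain-sign n (suc k) c d k<n cc (e , up@(x , _ , cc-e , refl , _) , chain) i 1≤i i≤k
  with ℕP.m≤n⇒m<n∨m≡n i≤k
... | inj₂ refl =
  subst (SignPreserved (get c i)) (sym (upChain-above n k e d chain i (ℕP.n<1+n k)))
        (up-sign n c e i 1≤i k<n cc up)
... | inj₁ (s≤s i≤k') =
  subst (λ a → SignPreserved a (get d i))
        (get-setAt-other c (suc k) x i (λ i≡ → ℕP.<-irrefl i≡ (s≤s i≤k')))
        (upChain-sign n k e d (ℕP.≤-trans (ℕP.n≤1+n k) k<n) cc-e chain i 1≤i i≤k')

mainTheorem9 : (n : ℕ) → 2 ≤ℕ n → (cm cM : Vec ℤ (n ∸ 1)) → Cell n cm cM →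
    (i : ℕ) → 1 ≤ℕ i → i ≤ℕ n ∸ 1 →
    ((get cm i < 0ℤ → get cM i ≤ 0ℤ) × (0ℤ ≤ get cm i → 0ℤ < get cM i))
mainTheorem9 n _ cm cM ((cc , _) , chain) i 1≤i i≤ =
  upChain-sign n (n ∸ 1) cm cM ℕP.≤-refl cc chain i 1≤i i≤
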